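{- Let $M$ be a matroid with ground set $\mathcal{A}$. For every positive integer $k$, the polynomial $T^{|\mathcal{A}|}_M$ determines $T^k_M$.
   Context: For a matroid $M$ on ground set $\mathcal{A}$ with rank function $\mathrm{rk}$ and a positive integer $k$, the $k$-th chain Tutte polynomial is $T^k_M((x_i)_1^k;(y_i)_1^k)=\sum_{S_1\subseteq\cdots\subseteq S_k\subseteq\mathcal{A}}\prod_{i=1}^k(x_i-1)^{\mathrm{rk}(\mathcal{A})-\mathrm{rk}(S_i)}(y_i-1)^{|S_i|-\mathrm{rk}(S_i)}$, summed over all weakly increasing chains of $k$ subsets of $\mathcal{A}$. -}

module Defs where

open import Data.Nat using (ℕ; zero; suc; _+_; _≤_; _∸_)
open import Data.Integer as ℤ using (ℤ; _-_; _^_; 1ℤ; 0ℤ)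
open import Data.Bool using (Bool; true; false; _∧_; if_then_else_)
open import Data.List using (List; []; _∷_; concatMap; map)
open import Data.Vec using (Vec; []; _∷_)
open import Data.Fin.Subset using (Subset; _⊆_; _∪_; _∩_; ∣_∣; ⊤; inside; outside)
open import Data.Fin.Subset.Properties using (_⊆?_)
open import Relation.Nullary.Decidable using (⌊_⌋)

record Matroid (n : ℕ) : Set where
  field
    rk          : Subset n → ℕ
    rk-bounded  : ∀ X → rk X ≤ ∣ X ∣
    rk-mono     : ∀ {X Y} → X ⊆ Y → rk X ≤ rk Y
    rk-submod   : ∀ X Y → rk (X ∪ Y) + rk (X ∩ Y) ≤ rk X + rk Y
open Matroid public

allSubsets : (n : ℕ) → List (Subset n)
allSubsets zero    = [] ∷ []
allSubsets (suc n) =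
  concatMap (λ S → (outside ∷ S) ∷ (inside ∷ S) ∷ []) (allSubsets n)

tuples : {A : Set} → List A → (k : ℕ) → List (Vec A k)
tuples xs zero    = [] ∷ []
tuples xs (suc k) = concatMap (λ x → map (x ∷_) (tuples xs k)) xs

isChain : {n k : ℕ} → Vec (Subset n) k → Bool
isChain []            = true
isChain (S ∷ [])      = true
isChain (S ∷ T ∷ Ss)  = ⌊ S ⊆? T ⌋ ∧ isChain (T ∷ Ss)

sumℤ : List ℤ → ℤ
sumℤ []       = 0ℤ
sumℤ (x ∷ xs) = x ℤ.+ sumℤ xs

chainTerm : {n k : ℕ} → Matroid n → Vec ℤ k → Vec ℤ k → Vec (Subset n) k → ℤ
chainTerm M []       []       []       = 1ℤ
chainTerm M (x ∷ xs) (y ∷ ys) (S ∷ Ss) =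
  ((x - 1ℤ) ^ (rk M ⊤ ∸ rk M S)) ℤ.* ((y - 1ℤ) ^ (∣ S ∣ ∸ rk M S))
    ℤ.* chainTerm M xs ys Ss

-- The k-th chain Tutte polynomial T^k_M, evaluated at integer points
-- (x_1,…,x_k; y_1,…,y_k).
chainTutte : {n : ℕ} → Matroid n → (k : ℕ) → Vec ℤ k → Vec ℤ k → ℤ
chainTutte {n} M k xs ys =
  sumℤ (map (λ Ss → if isChain Ss then chainTerm M xs ys Ss else 0ℤ)
            (tuples (allSubsets n) k))

-- Every chain S₁ ⊆ ⋯ ⊆ Sₖ contributes to Tᵏ the monomial ∏ (xᵢ - 1)^cᵢ (yᵢ - 1)^dᵢ with
-- (cᵢ , dᵢ) = (rk 𝒜 - rk Sᵢ , |Sᵢ| - rk Sᵢ), and all exponents are at most n = |𝒜|. Hence Tᵏ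
-- determines, and is determined by, the number of chains with each vector of statistics (cᵢ , dᵢ).
-- If S ⊆ T have the same statistic then S = T, so the statistics see where a chain repeats a set.
-- Deleting a repeated first set, the statistics of chains of length k + 1 give those of length k.
-- Conversely a chain of length k + 1 either arises from a chain of length k by doubling an entry
-- before its first repetition, or is strictly increasing; strictly increasing chains have length
-- at most n + 1, and those of length n + 1 start at ∅, whose statistic (rk 𝒜 , 0) is read off from
-- the chains of length 1. So the statistics of chains of length n determine those of every length.
module Submission where

open import Data.Bool using (Bool; true; false; not; _∧_; if_then_else_)
open import Data.Empty using (⊥-elim)
open import Data.Fin.Subset using (Subset; _⊆_; ∣_∣; ⊤; ⊥; inside; outside)
open import Data.Fin.Subset.Properties
  using (_⊆?_; ⊆-refl; ⊥⊆; ⊆⊤; drop-∷-⊆; p⊆q⇒∣p∣≤∣q∣; ∣p∣≤n; ∣⊥∣≡0; ∣⊤∣≡n)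
open import Data.Integer as ℤ using (ℤ; 0ℤ; 1ℤ; _+_; _*_; _-_; -_; _^_)
open import Data.Integer.Properties as ℤ using ()
open import Data.Integer.Tactic.RingSolver using (solve-∀)
open import Data.List using (List; []; _∷_; _++_; map; concatMap)
open import Data.List.Relation.Unary.All as ListAll using ([]; _∷_)
open import Data.List.Relation.Unary.All.Properties using (map⁺)
open import Data.Nat as ℕ using (ℕ; zero; suc; _≤_; _<_; _≤′_; z≤n; s≤s; _∸_; _≡ᵇ_; NonZero)
open import Data.Nat.Properties as ℕ using ()
open import Data.Product using (_×_; _,_; proj₁; proj₂)
open import Data.Product.Properties using (≡-dec)
open import Data.Sum using (inj₁; inj₂)
open import Data.Vec as Vec using (Vec; []; _∷_; here)
open import Data.Vec.Relation.Unary.All as VecAll using ([]; _∷_)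
open import Function using (_∘_)
open import Relation.Binary.Definitions using (DecidableEquality; tri<; tri≈; tri>)
open import Relation.Binary.PropositionalEquality
open import Relation.Nullary using (Dec; yes; no; contradiction)
open import Relation.Nullary.Decidable using (⌊_⌋)

open import Defs

open import Algebra.Properties.CommutativeSemigroup ℤ.+-commutativeSemigroup
  using () renaming (interchange to +-interchange)
open ≡-Reasoning

private
  variable
    A B : Set
    k m n D : ℕ

-- Finite sums

∑ : List A → (A → ℤ) → ℤ
∑ []       f = 0ℤ
∑ (x ∷ xs) f = f x + ∑ xs f

∑-cong : (xs : List A) {f g : A → ℤ} → (∀ x → f x ≡ g x) → ∑ xs f ≡ ∑ xs g
∑-cong []       f≗g = refl
∑-cong (x ∷ xs) f≗g = cong₂ _+_ (f≗g x) (∑-cong xs f≗g)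

∑-zero : (xs : List A) {f : A → ℤ} → (∀ x → f x ≡ 0ℤ) → ∑ xs f ≡ 0ℤ
∑-zero []       f≗0 = refl
∑-zero (x ∷ xs) f≗0 = cong₂ _+_ (f≗0 x) (∑-zero xs f≗0)

∑-++ : (xs ys : List A) (f : A → ℤ) → ∑ (xs ++ ys) f ≡ ∑ xs f + ∑ ys f
∑-++ []       ys f = sym (ℤ.+-identityˡ _)
∑-++ (x ∷ xs) ys f = trans (cong (f x +_) (∑-++ xs ys f)) (sym (ℤ.+-assoc (f x) _ _))

∑-map : (g : A → B) (xs : List A) (f : B → ℤ) → ∑ (map g xs) f ≡ ∑ xs (f ∘ g)
∑-map g []       f = refl
∑-map g (x ∷ xs) f = cong (f (g x) +_) (∑-map g xs f)

∑-concatMap : (g : A → List B) (xs : List A) (f : B → ℤ) →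
              ∑ (concatMap g xs) f ≡ ∑ xs (λ x → ∑ (g x) f)
∑-concatMap g []       f = refl
∑-concatMap g (x ∷ xs) f =
  trans (∑-++ (g x) (concatMap g xs) f) (cong (∑ (g x) f +_) (∑-concatMap g xs f))

∑-+ : (xs : List A) (f g : A → ℤ) → ∑ xs (λ x → f x + g x) ≡ ∑ xs f + ∑ xs g
∑-+ []       f g = refl
∑-+ (x ∷ xs) f g = trans (cong (f x + g x +_) (∑-+ xs f g)) (+-interchange (f x) (g x) _ _)

∑-*ˡ : (xs : List A) (c : ℤ) (f : A → ℤ) → ∑ xs (λ x → c * f x) ≡ c * ∑ xs f
∑-*ˡ []       c f = sym (ℤ.*-zeroʳ c)
∑-*ˡ (x ∷ xs) c f = trans (cong (c * f x +_) (∑-*ˡ xs c f)) (sym (ℤ.*-distribˡ-+ c (f x) _))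

∑-if : (xs : List A) (b : Bool) (f : A → ℤ) →
       ∑ xs (λ x → if b then f x else 0ℤ) ≡ (if b then ∑ xs f else 0ℤ)
∑-if xs true  f = refl
∑-if xs false f = ∑-zero xs (λ _ → refl)

-- Polynomial functions on the positive integers

∑≤ : ℕ → (ℕ → ℤ) → ℤ
∑≤ zero    f = f 0
∑≤ (suc D) f = f 0 + ∑≤ D (f ∘ suc)

∑≤-cong : ∀ D {f g : ℕ → ℤ} → (∀ {i} → i ≤ D → f i ≡ g i) → ∑≤ D f ≡ ∑≤ D g
∑≤-cong zero    f≗g = f≗g z≤n
∑≤-cong (suc D) f≗g = cong₂ _+_ (f≗g z≤n) (∑≤-cong D (f≗g ∘ s≤s))

∑≤-zero : ∀ D {f : ℕ → ℤ} → (∀ i → f i ≡ 0ℤ) → ∑≤ D f ≡ 0ℤ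
∑≤-zero zero    f≗0 = f≗0 0
∑≤-zero (suc D) f≗0 = cong₂ _+_ (f≗0 0) (∑≤-zero D (f≗0 ∘ suc))

∑≤-+ : ∀ D (f g : ℕ → ℤ) → ∑≤ D (λ i → f i + g i) ≡ ∑≤ D f + ∑≤ D g
∑≤-+ zero    f g = refl
∑≤-+ (suc D) f g = trans (cong (f 0 + g 0 +_) (∑≤-+ D _ _)) (+-interchange (f 0) (g 0) _ _)

∑≤-sub : ∀ D (f g : ℕ → ℤ) → ∑≤ D (λ i → f i - g i) ≡ ∑≤ D f - ∑≤ D g
∑≤-sub zero    f g = refl
∑≤-sub (suc D) f g = trans (cong (f 0 - g 0 +_) (∑≤-sub D _ _)) (regroup (f 0) (g 0) _ _)
  where
  regroup : ∀ a b c d → (a - b) + (c - d) ≡ (a + c) - (b + d)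
  regroup = solve-∀

∑≤-*ˡ : ∀ D (c : ℤ) (f : ℕ → ℤ) → ∑≤ D (λ i → c * f i) ≡ c * ∑≤ D f
∑≤-*ˡ zero    c f = refl
∑≤-*ˡ (suc D) c f = trans (cong (c * f 0 +_) (∑≤-*ˡ D c _)) (sym (ℤ.*-distribˡ-+ c (f 0) _))

∑≤-indicator : ∀ D {c} (f : ℕ → ℤ) → c ≤ D → ∑≤ D (λ i → if c ≡ᵇ i then f i else 0ℤ) ≡ f c
∑≤-indicator zero    {zero}  f z≤n     = refl
∑≤-indicator (suc D) {zero}  f z≤n     =
  trans (cong (f 0 +_) (∑≤-zero D λ _ → refl)) (ℤ.+-identityʳ (f 0))
∑≤-indicator (suc D) {suc c} f (s≤s c≤D) = trans (ℤ.+-identityˡ _) (∑≤-indicator D (f ∘ suc) c≤D)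

poly : ℕ → (ℕ → ℤ) → ℤ → ℤ
poly D c t = ∑≤ D (λ i → t ^ i * c i)

poly-suc : ∀ D (c : ℕ → ℤ) t → poly (suc D) c t ≡ c 0 + t * poly D (c ∘ suc) t
poly-suc D c t = cong₂ _+_ (ℤ.*-identityˡ (c 0))
  (trans (∑≤-cong D (λ {i} _ → ℤ.*-assoc t (t ^ i) (c (suc i)))) (∑≤-*ˡ D t _))

poly-sub : ∀ D (a b : ℕ → ℤ) t → poly D (λ i → a i - b i) t ≡ poly D a t - poly D b t
poly-sub D a b t = trans (∑≤-cong D (λ {i} _ → distrib (t ^ i) (a i) (b i))) (∑≤-sub D _ _)
  where
  distrib : ∀ x y z → x * (y - z) ≡ x * y - x * z
  distrib = solve-∀

n≡[1+n]*k⇒n≡0 : ∀ {n} k → n ≡ suc n ℕ.* k → n ≡ 0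
n≡[1+n]*k⇒n≡0 {n} zero    n≡0 = trans n≡0 (ℕ.*-zeroʳ (suc n))
n≡[1+n]*k⇒n≡0 {n} (suc k) n≡   =
  ⊥-elim (ℕ.<-irrefl refl (ℕ.≤-trans (ℕ.m≤m*n (suc n) (suc k)) (ℕ.≤-reflexive (sym n≡))))

poly-vanishing⇒coeffs≡0 : ∀ D (c : ℕ → ℤ) → (∀ m → poly D c (ℤ.+ suc m) ≡ 0ℤ) →
                          ∀ {i} → i ≤ D → c i ≡ 0ℤ
poly-vanishing⇒coeffs≡0 zero    c vanish z≤n = trans (sym (ℤ.*-identityˡ (c 0))) (vanish 0)
poly-vanishing⇒coeffs≡0 (suc D) c vanish     = coeffs≡0
  where
  P : ℤ → ℤ
  P = poly D (c ∘ suc)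

  root : ∀ m → c 0 + ℤ.+ suc m * P (ℤ.+ suc m) ≡ 0ℤ
  root m = trans (sym (poly-suc D c (ℤ.+ suc m))) (vanish m)

  i+j≡0⇒i≡-j : ∀ i j → i + j ≡ 0ℤ → i ≡ - j
  i+j≡0⇒i≡-j i j i+j≡0 = begin
    i             ≡⟨ regroup i j ⟩
    (i + j) + - j ≡⟨ cong (_+ - j) i+j≡0 ⟩
    0ℤ + - j      ≡⟨ ℤ.+-identityˡ (- j) ⟩
    - j           ∎
    where
    regroup : ∀ i j → i ≡ (i + j) + - j
    regroup = solve-∀

  -- evaluating at t = 1 + ∣ c 0 ∣ makes c 0 a multiple of t, but t exceeds ∣ c 0 ∣
  c₀≡0 : c 0 ≡ 0ℤ
  c₀≡0 = ℤ.∣i∣≡0⇒i≡0 (n≡[1+n]*k⇒n≡0 ℤ.∣ P t ∣ (begin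
    ℤ.∣ c 0 ∣          ≡⟨ cong ℤ.∣_∣ (i+j≡0⇒i≡-j (c 0) _ (root ℤ.∣ c 0 ∣)) ⟩
    ℤ.∣ - (t * P t) ∣  ≡⟨ ℤ.∣-i∣≡∣i∣ (t * P t) ⟩
    ℤ.∣ t * P t ∣      ≡⟨ ℤ.abs-* t (P t) ⟩
    suc ℤ.∣ c 0 ∣ ℕ.* ℤ.∣ P t ∣ ∎))
    where
    t = ℤ.+ suc ℤ.∣ c 0 ∣

  P-vanishing : ∀ m → P (ℤ.+ suc m) ≡ 0ℤ
  P-vanishing m with ℤ.i*j≡0⇒i≡0∨j≡0 t (trans (sym (ℤ.+-identityˡ (t * P t)))
                                              (trans (cong (_+ t * P t) (sym c₀≡0)) (root m)))
    where
    t = ℤ.+ suc m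
  ... | inj₂ Pt≡0 = Pt≡0

  coeffs≡0 : ∀ {i} → i ≤ suc D → c i ≡ 0ℤ
  coeffs≡0 {zero}  _         = c₀≡0
  coeffs≡0 {suc i} (s≤s i≤D) = poly-vanishing⇒coeffs≡0 D (c ∘ suc) P-vanishing i≤D

poly-injective : ∀ D (a b : ℕ → ℤ) → (∀ m → poly D a (ℤ.+ suc m) ≡ poly D b (ℤ.+ suc m)) →
                 ∀ {i} → i ≤ D → a i ≡ b i
poly-injective D a b a≗b i≤D = ℤ.i-j≡0⇒i≡j (a _) (b _)
  (poly-vanishing⇒coeffs≡0 D (λ i → a i - b i)
    (λ m → trans (poly-sub D a b _) (ℤ.i≡j⇒i-j≡0 (a≗b m))) i≤D)

monomial : Vec ℤ m → Vec ℕ m → ℤ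
monomial []       []       = 1ℤ
monomial (t ∷ ts) (e ∷ es) = t ^ e * monomial ts es

withHead : ℕ → List (Vec ℕ (suc m)) → List (Vec ℕ m)
withHead i []              = []
withHead i ((e ∷ es) ∷ E) = if e ≡ᵇ i then es ∷ withHead i E else withHead i E

Bounded : ℕ → List (Vec ℕ m) → Set
Bounded D = ListAll.All (VecAll.All (_≤ D))

withHead-bounded : ∀ {E : List (Vec ℕ (suc m))} i → Bounded D E → Bounded D (withHead i E)
withHead-bounded         i []                          = []
withHead-bounded {E = (e ∷ _) ∷ _} i ((_ ∷ es≤D) ∷ E≤D) with e ≡ᵇ i
... | true  = es≤D ∷ withHead-bounded i E≤D
... | false = withHead-bounded i E≤D

∑-byHead : ∀ {E : List (Vec ℕ (suc m))} → Bounded D E → (f : Vec ℕ (suc m) → ℤ) →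
           ∑ E f ≡ ∑≤ D (λ i → ∑ (withHead i E) (f ∘ (i ∷_)))
∑-byHead {D = D} []                             f = sym (∑≤-zero D λ _ → refl)
∑-byHead {D = D} {E = (e ∷ es) ∷ E} ((e≤D ∷ _) ∷ E≤D) f = begin
  f (e ∷ es) + ∑ E f
    ≡⟨ cong₂ _+_ (sym (∑≤-indicator D (λ i → f (i ∷ es)) e≤D)) (∑-byHead E≤D f) ⟩
  ∑≤ D (λ i → if e ≡ᵇ i then f (i ∷ es) else 0ℤ) + ∑≤ D (λ i → ∑ (withHead i E) (f ∘ (i ∷_)))
    ≡⟨ sym (∑≤-+ D _ _) ⟩
  ∑≤ D (λ i → (if e ≡ᵇ i then f (i ∷ es) else 0ℤ) + ∑ (withHead i E) (f ∘ (i ∷_)))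
    ≡⟨ ∑≤-cong D (λ {i} _ → split i) ⟩
  ∑≤ D (λ i → ∑ (withHead i ((e ∷ es) ∷ E)) (f ∘ (i ∷_)))
    ∎
  where
  split : ∀ i → (if e ≡ᵇ i then f (i ∷ es) else 0ℤ) + ∑ (withHead i E) (f ∘ (i ∷_))
              ≡ ∑ (withHead i ((e ∷ es) ∷ E)) (f ∘ (i ∷_))
  split i with e ≡ᵇ i
  ... | true  = refl
  ... | false = ℤ.+-identityˡ _

∑-nullary : (E : List (Vec ℕ 0)) (h : Vec ℕ 0 → ℤ) → ∑ E h ≡ h [] * ∑ E (monomial [])
∑-nullary []       h = sym (ℤ.*-zeroʳ (h []))
∑-nullary ([] ∷ E) h = begin
  h [] + ∑ E h                         ≡⟨ cong₂ _+_ (sym (ℤ.*-identityʳ (h []))) (∑-nullary E h) ⟩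
  h [] * 1ℤ + h [] * ∑ E (monomial []) ≡⟨ sym (ℤ.*-distribˡ-+ (h []) 1ℤ _) ⟩
  h [] * (1ℤ + ∑ E (monomial []))      ∎

-- A finite multiset of exponent vectors is determined by its generating polynomial, seen as a
-- function on ℤᵐ.
monomialSums-determine-∑ : ∀ D (E₁ E₂ : List (Vec ℕ m)) → Bounded D E₁ → Bounded D E₂ →
                           (∀ ts → ∑ E₁ (monomial ts) ≡ ∑ E₂ (monomial ts)) →
                           ∀ h → ∑ E₁ h ≡ ∑ E₂ h
monomialSums-determine-∑ {zero}  D E₁ E₂ _ _ E₁≈E₂ h =
  trans (∑-nullary E₁ h) (trans (cong (h [] *_) (E₁≈E₂ [])) (sym (∑-nullary E₂ h)))
monomialSums-determine-∑ {suc m} D E₁ E₂ E₁≤D E₂≤D E₁≈E₂ h = begin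
  ∑ E₁ h                                      ≡⟨ ∑-byHead E₁≤D h ⟩
  ∑≤ D (λ i → ∑ (withHead i E₁) (h ∘ (i ∷_))) ≡⟨ ∑≤-cong D (λ i≤D → monomialSums-determine-∑ D _ _
                                                   (withHead-bounded _ E₁≤D) (withHead-bounded _ E₂≤D)
                                                   (coefficient-≡ i≤D) _) ⟩
  ∑≤ D (λ i → ∑ (withHead i E₂) (h ∘ (i ∷_))) ≡⟨ sym (∑-byHead E₂≤D h) ⟩
  ∑ E₂ h                                      ∎
  where
  coefficient : List (Vec ℕ (suc m)) → Vec ℤ m → ℕ → ℤ
  coefficient E ts i = ∑ (withHead i E) (monomial ts)

  expand : ∀ {E} → Bounded D E → ∀ t ts → ∑ E (monomial (t ∷ ts)) ≡ poly D (coefficient E ts) t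
  expand {E} E≤D t ts = trans (∑-byHead E≤D _)
    (∑≤-cong D (λ {i} _ → ∑-*ˡ (withHead i E) (t ^ i) (monomial ts)))

  coefficient-≡ : ∀ {i} → i ≤ D → ∀ ts → coefficient E₁ ts i ≡ coefficient E₂ ts i
  coefficient-≡ i≤D ts = poly-injective D _ _
    (λ j → trans (sym (expand E₁≤D _ ts)) (trans (E₁≈E₂ (ℤ.+ suc j ∷ ts)) (expand E₂≤D _ ts))) i≤D

-- Chains of subsets

∑-allSubsets-suc : (f : Subset (suc n) → ℤ) →
                   ∑ (allSubsets (suc n)) f ≡ ∑ (allSubsets n) (λ S → f (outside ∷ S) + f (inside ∷ S))
∑-allSubsets-suc {n} f = trans (∑-concatMap _ (allSubsets n) f)
  (∑-cong (allSubsets n) (λ S → cong (f (outside ∷ S) +_) (ℤ.+-identityʳ _)))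

∑-allSubsets-single : (f : Subset n → ℤ) (X : Subset n) → (∀ S → S ≢ X → f S ≡ 0ℤ) →
                      ∑ (allSubsets n) f ≡ f X
∑-allSubsets-single         f []      f≗0 = ℤ.+-identityʳ (f [])
∑-allSubsets-single {suc n} f (x ∷ X) f≗0 = begin
  ∑ (allSubsets (suc n)) f                                   ≡⟨ ∑-allSubsets-suc f ⟩
  ∑ (allSubsets n) (λ S → f (outside ∷ S) + f (inside ∷ S))
    ≡⟨ ∑-allSubsets-single _ X (λ S S≢X → cong₂ _+_ (f≗0 _ (S≢X ∘ tail-≡)) (f≗0 _ (S≢X ∘ tail-≡))) ⟩
  f (outside ∷ X) + f (inside ∷ X)                           ≡⟨ other-zero x f≗0 ⟩
  f (x ∷ X)                                                  ∎
  where
  tail-≡ : ∀ {y S} → y ∷ S ≡ x ∷ X → S ≡ X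
  tail-≡ refl = refl
  other-zero : ∀ x → (∀ S → S ≢ x ∷ X → f S ≡ 0ℤ) → f (outside ∷ X) + f (inside ∷ X) ≡ f (x ∷ X)
  other-zero outside f≗0 = trans (cong (f (outside ∷ X) +_) (f≗0 _ λ ())) (ℤ.+-identityʳ _)
  other-zero inside  f≗0 = trans (cong (_+ f (inside ∷ X)) (f≗0 _ λ ())) (ℤ.+-identityˡ _)

∑⊇ : Subset n → (Subset n → ℤ) → ℤ
∑⊇ {n} L X = ∑ (allSubsets n) (λ S → if ⌊ L ⊆? S ⌋ then X S else 0ℤ)

∑⊇-cong : (L : Subset n) {X Y : Subset n → ℤ} → (∀ S → L ⊆ S → X S ≡ Y S) → ∑⊇ L X ≡ ∑⊇ L Y
∑⊇-cong {n} L X≗Y = ∑-cong (allSubsets n) pointwise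
  where
  pointwise : ∀ S → (if ⌊ L ⊆? S ⌋ then _ else 0ℤ) ≡ (if ⌊ L ⊆? S ⌋ then _ else 0ℤ)
  pointwise S with L ⊆? S
  ... | yes L⊆S = X≗Y S L⊆S
  ... | no  _   = refl

∑⊇-zero : (L : Subset n) {X : Subset n → ℤ} → (∀ S → L ⊆ S → X S ≡ 0ℤ) → ∑⊇ L X ≡ 0ℤ
∑⊇-zero {n} L X≗0 = ∑-zero (allSubsets n) pointwise
  where
  pointwise : ∀ S → (if ⌊ L ⊆? S ⌋ then _ else 0ℤ) ≡ 0ℤ
  pointwise S with L ⊆? S
  ... | yes L⊆S = X≗0 S L⊆S
  ... | no  _   = refl

∑⊇-+ : (L : Subset n) (X Y : Subset n → ℤ) → ∑⊇ L (λ S → X S + Y S) ≡ ∑⊇ L X + ∑⊇ L Y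
∑⊇-+ {n} L X Y = trans (∑-cong (allSubsets n) pointwise) (∑-+ (allSubsets n) _ _)
  where
  pointwise : ∀ S → (if ⌊ L ⊆? S ⌋ then X S + Y S else 0ℤ)
                  ≡ (if ⌊ L ⊆? S ⌋ then X S else 0ℤ) + (if ⌊ L ⊆? S ⌋ then Y S else 0ℤ)
  pointwise S with ⌊ L ⊆? S ⌋
  ... | true  = refl
  ... | false = refl

∑⊇-single : (L X : Subset n) {Y : Subset n → ℤ} → L ⊆ X → (∀ S → L ⊆ S → S ≢ X → Y S ≡ 0ℤ) →
            ∑⊇ L Y ≡ Y X
∑⊇-single L X {Y} L⊆X Y≗0 = trans (∑-allSubsets-single _ X off) on
  where
  off : ∀ S → S ≢ X → (if ⌊ L ⊆? S ⌋ then Y S else 0ℤ) ≡ 0ℤ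
  off S S≢X with L ⊆? S
  ... | yes L⊆S = Y≗0 S L⊆S S≢X
  ... | no  _   = refl
  on : (if ⌊ L ⊆? X ⌋ then Y X else 0ℤ) ≡ Y X
  on with L ⊆? X
  ... | yes _   = refl
  ... | no L⊈X = ⊥-elim (L⊈X L⊆X)

chainsAbove : ∀ k → Subset n → List (Vec (Subset n) k)
chainsAbove     zero    L = [] ∷ []
chainsAbove {n} (suc k) L =
  concatMap (λ S → if ⌊ L ⊆? S ⌋ then map (S ∷_) (chainsAbove k S) else []) (allSubsets n)

chainSum : ∀ k → Subset n → (Vec (Subset n) k → ℤ) → ℤ
chainSum k L F = ∑ (chainsAbove k L) F

chainSum-zero : (L : Subset n) (F : Vec (Subset n) 0 → ℤ) → chainSum 0 L F ≡ F []
chainSum-zero L F = ℤ.+-identityʳ (F [])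

chainSum-suc : ∀ k (L : Subset n) F → chainSum (suc k) L F ≡ ∑⊇ L (λ S → chainSum k S (F ∘ (S ∷_)))
chainSum-suc {n} k L F = trans (∑-concatMap _ (allSubsets n) F) (∑-cong (allSubsets n) first)
  where
  first : ∀ S → ∑ (if ⌊ L ⊆? S ⌋ then map (S ∷_) (chainsAbove k S) else []) F
              ≡ (if ⌊ L ⊆? S ⌋ then chainSum k S (F ∘ (S ∷_)) else 0ℤ)
  first S with ⌊ L ⊆? S ⌋
  ... | true  = ∑-map (S ∷_) (chainsAbove k S) F
  ... | false = refl

chainSum-cong : ∀ k (L : Subset n) {F G} → (∀ Ss → F Ss ≡ G Ss) → chainSum k L F ≡ chainSum k L G
chainSum-cong k L = ∑-cong (chainsAbove k L)

isChainAbove : Subset n → Vec (Subset n) k → Bool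
isChainAbove L []       = true
isChainAbove L (S ∷ Ss) = ⌊ L ⊆? S ⌋ ∧ isChain (S ∷ Ss)

isChain-∷ : (S : Subset n) (Ss : Vec (Subset n) k) → isChain (S ∷ Ss) ≡ isChainAbove S Ss
isChain-∷ S []       = refl
isChain-∷ S (T ∷ Ss) = refl

isChain-⊥ : (Ss : Vec (Subset n) k) → isChain Ss ≡ isChainAbove ⊥ Ss
isChain-⊥ []       = refl
isChain-⊥ (S ∷ Ss) with ⊥ ⊆? S
... | yes _   = refl
... | no ⊥⊈S = ⊥-elim (⊥⊈S ⊥⊆)

∑-tuples-isChainAbove : ∀ k (L : Subset n) F →
  ∑ (tuples (allSubsets n) k) (λ Ss → if isChainAbove L Ss then F Ss else 0ℤ) ≡ chainSum k L F
∑-tuples-isChainAbove         zero    L F = refl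
∑-tuples-isChainAbove {n = n} (suc k) L F = begin
  ∑ (concatMap (λ S → map (S ∷_) (tuples U k)) U) (λ Ss → if isChainAbove L Ss then F Ss else 0ℤ)
    ≡⟨ ∑-concatMap _ U _ ⟩
  ∑ U (λ S → ∑ (map (S ∷_) (tuples U k)) (λ Ss → if isChainAbove L Ss then F Ss else 0ℤ))
    ≡⟨ ∑-cong U (λ S → trans (∑-map (S ∷_) (tuples U k) _) (headStep S)) ⟩
  ∑ U (λ S → if ⌊ L ⊆? S ⌋ then chainSum k S (F ∘ (S ∷_)) else 0ℤ)
    ≡⟨ sym (chainSum-suc k L F) ⟩
  chainSum (suc k) L F
    ∎
  where
  U = allSubsets n
  if-∧ : ∀ b c (x : ℤ) → (if b ∧ c then x else 0ℤ) ≡ (if b then (if c then x else 0ℤ) else 0ℤ)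
  if-∧ true  c x = refl
  if-∧ false c x = refl
  headStep : ∀ S → ∑ (tuples U k) (λ Ss → if ⌊ L ⊆? S ⌋ ∧ isChain (S ∷ Ss) then F (S ∷ Ss) else 0ℤ)
                 ≡ (if ⌊ L ⊆? S ⌋ then chainSum k S (F ∘ (S ∷_)) else 0ℤ)
  headStep S = begin
    ∑ (tuples U k) (λ Ss → if ⌊ L ⊆? S ⌋ ∧ isChain (S ∷ Ss) then F (S ∷ Ss) else 0ℤ)
      ≡⟨ ∑-cong (tuples U k) (λ Ss → trans (cong (λ b → if ⌊ L ⊆? S ⌋ ∧ b then F (S ∷ Ss) else 0ℤ)
                                                  (isChain-∷ S Ss))
                                            (if-∧ ⌊ L ⊆? S ⌋ (isChainAbove S Ss) (F (S ∷ Ss)))) ⟩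
    ∑ (tuples U k) (λ Ss → if ⌊ L ⊆? S ⌋ then (if isChainAbove S Ss then F (S ∷ Ss) else 0ℤ) else 0ℤ)
      ≡⟨ ∑-if (tuples U k) ⌊ L ⊆? S ⌋ _ ⟩
    (if ⌊ L ⊆? S ⌋ then ∑ (tuples U k) (λ Ss → if isChainAbove S Ss then F (S ∷ Ss) else 0ℤ) else 0ℤ)
      ≡⟨ cong (λ x → if ⌊ L ⊆? S ⌋ then x else 0ℤ) (∑-tuples-isChainAbove k S (F ∘ (S ∷_))) ⟩
    (if ⌊ L ⊆? S ⌋ then chainSum k S (F ∘ (S ∷_)) else 0ℤ)
      ∎

sumℤ-map : (g : A → ℤ) (xs : List A) → sumℤ (map g xs) ≡ ∑ xs g
sumℤ-map g []       = refl
sumℤ-map g (x ∷ xs) = cong (g x +_) (sumℤ-map g xs)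

chainTutte≡chainSum : (M : Matroid n) (k : ℕ) (xs ys : Vec ℤ k) →
                      chainTutte M k xs ys ≡ chainSum k ⊥ (chainTerm M xs ys)
chainTutte≡chainSum {n} M k xs ys = begin
  chainTutte M k xs ys
    ≡⟨ sumℤ-map _ (tuples (allSubsets n) k) ⟩
  ∑ (tuples (allSubsets n) k) (λ Ss → if isChain Ss then chainTerm M xs ys Ss else 0ℤ)
    ≡⟨ ∑-cong (tuples (allSubsets n) k)
         (λ Ss → cong (λ b → if b then chainTerm M xs ys Ss else 0ℤ) (isChain-⊥ Ss)) ⟩
  ∑ (tuples (allSubsets n) k) (λ Ss → if isChainAbove ⊥ Ss then chainTerm M xs ys Ss else 0ℤ)
    ≡⟨ ∑-tuples-isChainAbove k ⊥ _ ⟩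
  chainSum k ⊥ (chainTerm M xs ys) ∎

p⊆q∧∣p∣≡∣q∣⇒p≡q : {p q : Subset n} → p ⊆ q → ∣ p ∣ ≡ ∣ q ∣ → p ≡ q
p⊆q∧∣p∣≡∣q∣⇒p≡q {p = []}          {[]}          _   _  = refl
p⊆q∧∣p∣≡∣q∣⇒p≡q {p = outside ∷ p} {outside ∷ q} p⊆q eq =
  cong (outside ∷_) (p⊆q∧∣p∣≡∣q∣⇒p≡q (drop-∷-⊆ p⊆q) eq)
p⊆q∧∣p∣≡∣q∣⇒p≡q {p = outside ∷ p} {inside  ∷ q} p⊆q eq =
  ⊥-elim (ℕ.<-irrefl eq (s≤s (p⊆q⇒∣p∣≤∣q∣ (drop-∷-⊆ p⊆q))))
p⊆q∧∣p∣≡∣q∣⇒p≡q {p = inside  ∷ p} {outside ∷ q} p⊆q eq = contradiction (p⊆q here) λ ()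
p⊆q∧∣p∣≡∣q∣⇒p≡q {p = inside  ∷ p} {inside  ∷ q} p⊆q eq =
  cong (inside ∷_) (p⊆q∧∣p∣≡∣q∣⇒p≡q (drop-∷-⊆ p⊆q) (ℕ.suc-injective eq))

p⊆q∧p≢q⇒∣p∣<∣q∣ : {p q : Subset n} → p ⊆ q → p ≢ q → ∣ p ∣ < ∣ q ∣
p⊆q∧p≢q⇒∣p∣<∣q∣ p⊆q p≢q = ℕ.≤∧≢⇒< (p⊆q⇒∣p∣≤∣q∣ p⊆q) (p≢q ∘ p⊆q∧∣p∣≡∣q∣⇒p≡q p⊆q)

-- Chain statistics of a matroid

Stat : Set
Stat = ℕ × ℕ

_≟ₛ_ : DecidableEquality Stat
_≟ₛ_ = ≡-dec ℕ._≟_ ℕ._≟_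

_≉head_ : Stat → Vec Stat k → Bool
a ≉head []      = true
a ≉head (b ∷ _) = not ⌊ a ≟ₛ b ⌋

consFresh : Stat → (Vec Stat (suc k) → ℤ) → Vec Stat k → ℤ
consFresh a h σ = if a ≉head σ then h (a ∷ σ) else 0ℤ

-- onStrict h σ is h σ if no two consecutive entries of σ are equal, and 0 otherwise.
onStrict : (Vec Stat k → ℤ) → Vec Stat k → ℤ
onStrict h []      = h []
onStrict h (a ∷ σ) = onStrict (consFresh a h) σ

-- insertRepeat h σ sums h over the vectors obtained from σ by repeating one entry σᵢ, for every
-- i up to the first place where σ already repeats an entry.
insertRepeat : (Vec Stat (suc k) → ℤ) → Vec Stat k → ℤ
insertRepeat h []      = 0ℤ
insertRepeat h (a ∷ σ) = h (a ∷ a ∷ σ) + insertRepeat (consFresh a h) σ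

dropRepeatedHead : (Vec Stat (suc k) → ℤ) → Vec Stat (suc (suc k)) → ℤ
dropRepeatedHead h (a ∷ b ∷ σ) = if ⌊ a ≟ₛ b ⌋ then h (b ∷ σ) else 0ℤ

isStat : Stat → Vec Stat 1 → ℤ
isStat s (a ∷ []) = if ⌊ a ≟ₛ s ⌋ then 1ℤ else 0ℤ

onStrict-zero : {h : Vec Stat k → ℤ} → (∀ σ → h σ ≡ 0ℤ) → ∀ σ → onStrict h σ ≡ 0ℤ
onStrict-zero h≗0 []      = h≗0 []
onStrict-zero {h = h} h≗0 (a ∷ σ) = onStrict-zero consFresh≗0 σ
  where
  consFresh≗0 : ∀ τ → consFresh a h τ ≡ 0ℤ
  consFresh≗0 τ with a ≉head τ
  ... | true  = h≗0 (a ∷ τ)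
  ... | false = refl

onStrict-repeat : (h : Vec Stat (suc (suc k)) → ℤ) (a : Stat) (σ : Vec Stat k) →
                  onStrict h (a ∷ a ∷ σ) ≡ 0ℤ
onStrict-repeat h a = onStrict-zero vanish
  where
  vanish : ∀ τ → consFresh a (consFresh a h) τ ≡ 0ℤ
  vanish τ with a ≉head τ | a ≟ₛ a
  ... | false | _       = refl
  ... | true  | yes _   = refl
  ... | true  | no a≢a = ⊥-elim (a≢a refl)

module Statistics {n : ℕ} (M : Matroid n) where

  rank : ℕ
  rank = rk M ⊤

  stat : Subset n → Stat
  stat S = rank ∸ rk M S , ∣ S ∣ ∸ rk M S

  stats : Vec (Subset n) k → Vec Stat k
  stats = Vec.map stat

  statSum : ∀ k → (Vec Stat k → ℤ) → ℤ
  statSum k h = chainSum k ⊥ (h ∘ stats)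

  rank≤n : rank ≤ n
  rank≤n = ℕ.≤-trans (rk-bounded M ⊤) (ℕ.≤-reflexive (∣⊤∣≡n n))

  stat-⊥ : stat ⊥ ≡ (rank , 0)
  stat-⊥ rewrite ℕ.n≤0⇒n≡0 (ℕ.≤-trans (rk-bounded M ⊥) (ℕ.≤-reflexive (∣⊥∣≡0 n))) | ∣⊥∣≡0 n = refl

  stat-injective-⊆ : ∀ {S T} → S ⊆ T → stat S ≡ stat T → S ≡ T
  stat-injective-⊆ {S} {T} S⊆T stat≡ = p⊆q∧∣p∣≡∣q∣⇒p≡q S⊆T (begin
    ∣ S ∣                         ≡⟨ sym (ℕ.m∸n+n≡m (rk-bounded M S)) ⟩
    (∣ S ∣ ∸ rk M S) ℕ.+ rk M S  ≡⟨ cong₂ ℕ._+_ (cong proj₂ stat≡) rk≡ ⟩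
    (∣ T ∣ ∸ rk M T) ℕ.+ rk M T  ≡⟨ ℕ.m∸n+n≡m (rk-bounded M T) ⟩
    ∣ T ∣                         ∎)
    where
    rk≡ : rk M S ≡ rk M T
    rk≡ = ℕ.∸-cancelˡ-≡ (rk-mono M ⊆⊤) (rk-mono M ⊆⊤) (cong proj₁ stat≡)

  ∑⊇-collapse : ∀ S (X : Subset n → ℤ) → ∑⊇ S (λ T → if ⌊ stat S ≟ₛ stat T ⌋ then X T else 0ℤ) ≡ X S
  ∑⊇-collapse S X = trans (∑⊇-single S S ⊆-refl off) diagonal
    where
    off : ∀ T → S ⊆ T → T ≢ S → (if ⌊ stat S ≟ₛ stat T ⌋ then X T else 0ℤ) ≡ 0ℤ
    off T S⊆T T≢S with stat S ≟ₛ stat T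
    ... | yes stat≡ = ⊥-elim (T≢S (sym (stat-injective-⊆ S⊆T stat≡)))
    ... | no  _     = refl
    diagonal : (if ⌊ stat S ≟ₛ stat S ⌋ then X S else 0ℤ) ≡ X S
    diagonal with stat S ≟ₛ stat S
    ... | yes _   = refl
    ... | no s≢s = ⊥-elim (s≢s refl)

  chainSum-splitHead : ∀ k S (G : Vec (Subset n) (suc k) → ℤ) →
    chainSum (suc k) S G ≡
    chainSum k S (G ∘ (S ∷_)) + chainSum (suc k) S (λ w → if stat S ≉head stats w then G w else 0ℤ)
  chainSum-splitHead k S G = begin
    chainSum (suc k) S G
      ≡⟨ chainSum-suc k S G ⟩
    ∑⊇ S X
      ≡⟨ ∑⊇-cong S (λ T _ → split T) ⟩
    ∑⊇ S (λ T → (if same T then X T else 0ℤ) + (if not (same T) then X T else 0ℤ))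
      ≡⟨ ∑⊇-+ S _ _ ⟩
    ∑⊇ S (λ T → if same T then X T else 0ℤ) + ∑⊇ S (λ T → if not (same T) then X T else 0ℤ)
      ≡⟨ cong₂ _+_ (∑⊇-collapse S X) (∑⊇-cong S (λ T _ → sym (∑-if (chainsAbove k T) _ _))) ⟩
    X S + ∑⊇ S (λ T → chainSum k T (λ v → if not (same T) then G (T ∷ v) else 0ℤ))
      ≡⟨ cong (X S +_) (sym (chainSum-suc k S _)) ⟩
    X S + chainSum (suc k) S (λ w → if stat S ≉head stats w then G w else 0ℤ)
      ∎
    where
    same : Subset n → Bool
    same T = ⌊ stat S ≟ₛ stat T ⌋
    X : Subset n → ℤ
    X T = chainSum k T (G ∘ (T ∷_))
    split : ∀ T → X T ≡ (if same T then X T else 0ℤ) + (if not (same T) then X T else 0ℤ)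
    split T with same T
    ... | true  = sym (ℤ.+-identityʳ (X T))
    ... | false = sym (ℤ.+-identityˡ (X T))

  chainSum-dropRepeatedHead : ∀ k L (h : Vec Stat (suc k) → ℤ) →
    chainSum (suc (suc k)) L (dropRepeatedHead h ∘ stats) ≡ chainSum (suc k) L (h ∘ stats)
  chainSum-dropRepeatedHead k L h = begin
    chainSum (suc (suc k)) L (dropRepeatedHead h ∘ stats)
      ≡⟨ chainSum-suc (suc k) L _ ⟩
    ∑⊇ L (λ S → chainSum (suc k) S (λ w → dropRepeatedHead h (stat S ∷ stats w)))
      ≡⟨ ∑⊇-cong L (λ S _ → collapseSecond S) ⟩
    ∑⊇ L (λ S → chainSum k S (λ v → h (stat S ∷ stats v)))
      ≡⟨ sym (chainSum-suc k L _) ⟩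
    chainSum (suc k) L (h ∘ stats)
      ∎
    where
    collapseSecond : ∀ S → chainSum (suc k) S (λ w → dropRepeatedHead h (stat S ∷ stats w))
                         ≡ chainSum k S (λ v → h (stat S ∷ stats v))
    collapseSecond S = begin
      chainSum (suc k) S (λ w → dropRepeatedHead h (stat S ∷ stats w))
        ≡⟨ chainSum-suc k S _ ⟩
      ∑⊇ S (λ T → chainSum k T (λ v → if ⌊ stat S ≟ₛ stat T ⌋ then h (stat T ∷ stats v) else 0ℤ))
        ≡⟨ ∑⊇-cong S (λ T _ → ∑-if (chainsAbove k T) _ _) ⟩
      ∑⊇ S (λ T → if ⌊ stat S ≟ₛ stat T ⌋ then chainSum k T (λ v → h (stat T ∷ stats v)) else 0ℤ)
        ≡⟨ ∑⊇-collapse S _ ⟩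
      chainSum k S (λ v → h (stat S ∷ stats v))
        ∎

  chainSum-insertRepeat : ∀ k L (h : Vec Stat (suc k) → ℤ) →
    chainSum (suc k) L (h ∘ stats) ≡
    chainSum k L (insertRepeat h ∘ stats) + chainSum (suc k) L (onStrict h ∘ stats)

  chainSum-insertRepeat-∷ : ∀ k S (h : Vec Stat (suc (suc k)) → ℤ) →
    chainSum (suc k) S (λ w → h (stat S ∷ stats w)) ≡
    chainSum k S (λ v → insertRepeat h (stat S ∷ stats v)) +
    chainSum (suc k) S (λ w → onStrict h (stat S ∷ stats w))

  chainSum-insertRepeat zero    L h = trans (chainSum-cong 1 L singleton) (sym (ℤ.+-identityˡ _))
    where
    singleton : ∀ w → h (stats w) ≡ onStrict h (stats w)
    singleton (S ∷ []) = refl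
  chainSum-insertRepeat (suc k) L h = begin
    chainSum (suc (suc k)) L (h ∘ stats)
      ≡⟨ chainSum-suc (suc k) L _ ⟩
    ∑⊇ L (λ S → chainSum (suc k) S (λ w → h (stat S ∷ stats w)))
      ≡⟨ ∑⊇-cong L (λ S _ → chainSum-insertRepeat-∷ k S h) ⟩
    ∑⊇ L (λ S → repeating S + strict S)
      ≡⟨ ∑⊇-+ L repeating strict ⟩
    ∑⊇ L repeating + ∑⊇ L strict
      ≡⟨ sym (cong₂ _+_ (chainSum-suc k L _) (chainSum-suc (suc k) L _)) ⟩
    chainSum (suc k) L (insertRepeat h ∘ stats) + chainSum (suc (suc k)) L (onStrict h ∘ stats)
      ∎
    where
    repeating strict : Subset n → ℤ
    repeating S = chainSum k S (λ v → insertRepeat h (stat S ∷ stats v))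
    strict    S = chainSum (suc k) S (λ w → onStrict h (stat S ∷ stats w))

  chainSum-insertRepeat-∷ k S h = begin
    chainSum (suc k) S (λ w → h (a ∷ stats w))
      ≡⟨ chainSum-splitHead k S _ ⟩
    repeatedHead + chainSum (suc k) S (consFresh a h ∘ stats)
      ≡⟨ cong (repeatedHead +_) (chainSum-insertRepeat k S (consFresh a h)) ⟩
    repeatedHead + (repeatedLater + strict)
      ≡⟨ sym (ℤ.+-assoc repeatedHead repeatedLater strict) ⟩
    (repeatedHead + repeatedLater) + strict
      ≡⟨ cong (_+ strict) (sym (∑-+ (chainsAbove k S) _ _)) ⟩
    chainSum k S (λ v → insertRepeat h (a ∷ stats v)) +
    chainSum (suc k) S (λ w → onStrict h (a ∷ stats w))
      ∎
    where
    a = stat S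
    repeatedHead repeatedLater strict : ℤ
    repeatedHead  = chainSum k S (λ v → h (a ∷ a ∷ stats v))
    repeatedLater = chainSum k S (insertRepeat (consFresh a h) ∘ stats)
    strict        = chainSum (suc k) S (onStrict (consFresh a h) ∘ stats)

  chainSum-onStrict-long : ∀ k S (h : Vec Stat (suc k) → ℤ) → n < ∣ S ∣ ℕ.+ k →
                           chainSum k S (λ v → onStrict h (stat S ∷ stats v)) ≡ 0ℤ
  chainSum-onStrict-long zero    S h n<∣S∣+0 =
    ⊥-elim (ℕ.<-irrefl refl (ℕ.<-≤-trans n<∣S∣+0 (ℕ.≤-trans (ℕ.≤-reflexive (ℕ.+-identityʳ _)) (∣p∣≤n S))))
  chainSum-onStrict-long (suc k) S h n<∣S∣+1+k =
    trans (chainSum-suc k S _) (∑⊇-zero S λ T S⊆T → vanish T S⊆T (stat S ≟ₛ stat T))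
    where
    vanish : ∀ T → S ⊆ T → Dec (stat S ≡ stat T) →
             chainSum k T (λ v → onStrict h (stat S ∷ stat T ∷ stats v)) ≡ 0ℤ
    vanish T S⊆T (yes stat≡) = ∑-zero (chainsAbove k T) λ v →
      trans (cong (λ b → onStrict h (stat S ∷ b ∷ stats v)) (sym stat≡))
            (onStrict-repeat h (stat S) (stats v))
    vanish T S⊆T (no stat≢) = chainSum-onStrict-long k T (consFresh (stat S) h)
      (ℕ.<-≤-trans n<∣S∣+1+k (ℕ.≤-trans (ℕ.≤-reflexive (ℕ.+-suc ∣ S ∣ k))
                                         (ℕ.+-monoˡ-≤ k (p⊆q∧p≢q⇒∣p∣<∣q∣ S⊆T (stat≢ ∘ cong stat)))))

  statSum-onStrict : ∀ m (h : Vec Stat (suc m) → ℤ) → n ≤ m →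
                     statSum (suc m) (onStrict h) ≡ statSum m (onStrict (consFresh (rank , 0) h))
  statSum-onStrict m h n≤m = begin
    statSum (suc m) (onStrict h)
      ≡⟨ chainSum-suc m ⊥ (onStrict h ∘ stats) ⟩
    ∑⊇ ⊥ (λ S → chainSum m S (λ v → onStrict h (stat S ∷ stats v)))
      ≡⟨ ∑⊇-single ⊥ ⊥ ⊥⊆ (λ S _ S≢⊥ → chainSum-onStrict-long m S h (nonempty-long S≢⊥)) ⟩
    chainSum m ⊥ (λ v → onStrict h (stat ⊥ ∷ stats v))
      ≡⟨ cong (λ a → chainSum m ⊥ (λ v → onStrict h (a ∷ stats v))) stat-⊥ ⟩
    statSum m (onStrict (consFresh (rank , 0) h))
      ∎
    where
    nonempty-long : ∀ {S} → S ≢ ⊥ → n < ∣ S ∣ ℕ.+ m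
    nonempty-long S≢⊥ = ℕ.<-≤-trans (s≤s n≤m) (ℕ.+-monoˡ-≤ m
      (ℕ.≤-trans (ℕ.≤-reflexive (cong suc (sym (∣⊥∣≡0 n)))) (p⊆q∧p≢q⇒∣p∣<∣q∣ ⊥⊆ (S≢⊥ ∘ sym))))

  statSum-one : ∀ h → statSum 1 h ≡ ∑⊇ ⊥ (λ S → h (stat S ∷ []))
  statSum-one h = trans (chainSum-suc 0 ⊥ (h ∘ stats))
                        (∑⊇-cong ⊥ (λ S _ → chainSum-zero S (λ v → h (stat S ∷ stats v))))

  statSum-isStat-rank : statSum 1 (isStat (rank , 0)) ≡ 1ℤ
  statSum-isStat-rank = begin
    statSum 1 (isStat (rank , 0))               ≡⟨ statSum-one (isStat (rank , 0)) ⟩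
    ∑⊇ ⊥ (λ S → isStat (rank , 0) (stat S ∷ [])) ≡⟨ ∑⊇-single ⊥ ⊥ ⊥⊆ off ⟩
    isStat (rank , 0) (stat ⊥ ∷ [])             ≡⟨ cong (λ a → isStat (rank , 0) (a ∷ [])) stat-⊥ ⟩
    isStat (rank , 0) ((rank , 0) ∷ [])         ≡⟨ diagonal ⟩
    1ℤ                                          ∎
    where
    off : ∀ S → ⊥ ⊆ S → S ≢ ⊥ → isStat (rank , 0) (stat S ∷ []) ≡ 0ℤ
    off S _ S≢⊥ with stat S ≟ₛ (rank , 0)
    ... | yes stat≡ = ⊥-elim (S≢⊥ (sym (stat-injective-⊆ ⊥⊆ (trans stat-⊥ (sym stat≡)))))
    ... | no  _     = refl
    diagonal : isStat (rank , 0) ((rank , 0) ∷ []) ≡ 1ℤ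
    diagonal with (rank , 0) ≟ₛ (rank , 0)
    ... | yes _   = refl
    ... | no s≢s = ⊥-elim (s≢s refl)

  statSum-isStat-aboveRank : ∀ {j} → rank < j → statSum 1 (isStat (j , 0)) ≡ 0ℤ
  statSum-isStat-aboveRank {j} rank<j =
    trans (statSum-one (isStat (j , 0))) (∑⊇-zero ⊥ λ S _ → off S)
    where
    off : ∀ S → isStat (j , 0) (stat S ∷ []) ≡ 0ℤ
    off S with stat S ≟ₛ (j , 0)
    ... | yes stat≡ =
      ⊥-elim (ℕ.<-irrefl (cong proj₁ stat≡) (ℕ.≤-<-trans (ℕ.m∸n≤m rank (rk M S)) rank<j))
    ... | no  _     = refl

open Statistics using (rank; rank≤n; stats; statSum)

-- Matroids with the same chain statistics

record _≋[_]_ (M : Matroid n) (k : ℕ) (N : Matroid n) : Set where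
  constructor sameStatSums
  field statSum-≡ : ∀ h → statSum M k h ≡ statSum N k h
open _≋[_]_

≋-descend : {M N : Matroid n} → M ≋[ suc (suc k) ] N → M ≋[ suc k ] N
≋-descend {k = k} {M} {N} M≋N = sameStatSums λ h → begin
  statSum M (suc k) h                        ≡⟨ sym (Statistics.chainSum-dropRepeatedHead M k ⊥ h) ⟩
  statSum M (suc (suc k)) (dropRepeatedHead h) ≡⟨ statSum-≡ M≋N (dropRepeatedHead h) ⟩
  statSum N (suc (suc k)) (dropRepeatedHead h) ≡⟨ Statistics.chainSum-dropRepeatedHead N k ⊥ h ⟩
  statSum N (suc k) h                        ∎

≋-descend* : {M N : Matroid n} → k ≤′ m → M ≋[ suc m ] N → M ≋[ suc k ] N
≋-descend* ℕ.≤′-refl          M≋N = M≋N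
≋-descend* (ℕ.≤′-step k≤′m) M≋N = ≋-descend* k≤′m (≋-descend M≋N)

≋[1]⇒rank≡ : {M N : Matroid n} → M ≋[ 1 ] N → rank M ≡ rank N
≋[1]⇒rank≡ {M = M} {N} M≋N with ℕ.<-cmp (rank M) (rank N)
... | tri< rM<rN _ _ = contradiction (begin
  1ℤ                                 ≡⟨ sym (Statistics.statSum-isStat-rank N) ⟩
  statSum N 1 (isStat (rank N , 0))  ≡⟨ sym (statSum-≡ M≋N (isStat (rank N , 0))) ⟩
  statSum M 1 (isStat (rank N , 0))  ≡⟨ Statistics.statSum-isStat-aboveRank M rM<rN ⟩
  0ℤ                                 ∎) λ ()
... | tri≈ _ rM≡rN _ = rM≡rN
... | tri> _ _ rN<rM = contradiction (begin
  1ℤ                                 ≡⟨ sym (Statistics.statSum-isStat-rank M) ⟩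
  statSum M 1 (isStat (rank M , 0))  ≡⟨ statSum-≡ M≋N (isStat (rank M , 0)) ⟩
  statSum N 1 (isStat (rank M , 0))  ≡⟨ Statistics.statSum-isStat-aboveRank N rN<rM ⟩
  0ℤ                                 ∎) λ ()

≋⇒rank≡ : {M N : Matroid n} → M ≋[ n ] N → rank M ≡ rank N
≋⇒rank≡ {zero}  {M} {N} _   = trans (ℕ.n≤0⇒n≡0 (rank≤n M)) (sym (ℕ.n≤0⇒n≡0 (rank≤n N)))
≋⇒rank≡ {suc n}         M≋N = ≋[1]⇒rank≡ (≋-descend* ℕ.z≤′n M≋N)

-- A chain of m + 1 ≥ n + 1 subsets either repeats a set, or it is strictly increasing, hence a
-- complete flag starting at ⊥, whose statistic (rank, 0) is known.
≋-ascend : {M N : Matroid n} → n ≤ m → rank M ≡ rank N → M ≋[ m ] N → M ≋[ suc m ] N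
≋-ascend {m = m} {M} {N} n≤m rM≡rN M≋N = sameStatSums λ h → begin
  statSum M (suc m) h
    ≡⟨ Statistics.chainSum-insertRepeat M m ⊥ h ⟩
  statSum M m (insertRepeat h) + statSum M (suc m) (onStrict h)
    ≡⟨ cong (statSum M m (insertRepeat h) +_) (Statistics.statSum-onStrict M m h n≤m) ⟩
  statSum M m (insertRepeat h) + statSum M m (onStrict (consFresh (rank M , 0) h))
    ≡⟨ cong₂ _+_ (statSum-≡ M≋N (insertRepeat h))
                 (trans (statSum-≡ M≋N (onStrict (consFresh (rank M , 0) h)))
                        (cong (λ r → statSum N m (onStrict (consFresh (r , 0) h))) rM≡rN)) ⟩
  statSum N m (insertRepeat h) + statSum N m (onStrict (consFresh (rank N , 0) h))
    ≡⟨ cong (statSum N m (insertRepeat h) +_) (sym (Statistics.statSum-onStrict N m h n≤m)) ⟩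
  statSum N m (insertRepeat h) + statSum N (suc m) (onStrict h)
    ≡⟨ sym (Statistics.chainSum-insertRepeat N m ⊥ h) ⟩
  statSum N (suc m) h
    ∎

≋-ascend* : {M N : Matroid n} → n ≤′ m → rank M ≡ rank N → M ≋[ n ] N → M ≋[ m ] N
≋-ascend* ℕ.≤′-refl          rM≡rN M≋N = M≋N
≋-ascend* (ℕ.≤′-step n≤′m) rM≡rN M≋N = ≋-ascend (ℕ.≤′⇒≤ n≤′m) rM≡rN (≋-ascend* n≤′m rM≡rN M≋N)

≋-everywhere : {M N : Matroid n} → M ≋[ n ] N → ∀ k → M ≋[ suc k ] N
≋-everywhere {n} M≋N k with ℕ.≤-total (suc k) n
... | inj₁ (s≤s k≤n-1) = ≋-descend* (ℕ.≤⇒≤′ k≤n-1) M≋N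
... | inj₂ n≤1+k       = ≋-ascend* (ℕ.≤⇒≤′ n≤1+k) (≋⇒rank≡ M≋N) M≋N

chainMonomial : Vec ℤ k → Vec ℤ k → Vec Stat k → ℤ
chainMonomial []       []       []             = 1ℤ
chainMonomial (x ∷ xs) (y ∷ ys) ((c , d) ∷ σ) = (x - 1ℤ) ^ c * (y - 1ℤ) ^ d * chainMonomial xs ys σ

chainTutte≡statSum : (M : Matroid n) (k : ℕ) (xs ys : Vec ℤ k) →
                     chainTutte M k xs ys ≡ statSum M k (chainMonomial xs ys)
chainTutte≡statSum M k xs ys = trans (chainTutte≡chainSum M k xs ys) (chainSum-cong k ⊥ (term≡ xs ys))
  where
  term≡ : ∀ {k} (xs ys : Vec ℤ k) Ss → chainTerm M xs ys Ss ≡ chainMonomial xs ys (stats M Ss)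
  term≡ []       []       []       = refl
  term≡ (x ∷ xs) (y ∷ ys) (S ∷ Ss) =
    cong ((x - 1ℤ) ^ (rank M ∸ rk M S) * (y - 1ℤ) ^ (∣ S ∣ ∸ rk M S) *_) (term≡ xs ys Ss)

flatten : Vec Stat k → Vec ℕ (k ℕ.* 2)
flatten []             = []
flatten ((c , d) ∷ σ) = c ∷ d ∷ flatten σ

unflatten : Vec ℕ (k ℕ.* 2) → Vec Stat k
unflatten {zero}  []           = []
unflatten {suc k} (c ∷ d ∷ es) = (c , d) ∷ unflatten es

unflatten-flatten : (σ : Vec Stat k) → unflatten (flatten σ) ≡ σ
unflatten-flatten []             = refl
unflatten-flatten ((c , d) ∷ σ) = cong ((c , d) ∷_) (unflatten-flatten σ)

xsOf ysOf : Vec ℤ (k ℕ.* 2) → Vec ℤ k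
xsOf {zero}  []           = []
xsOf {suc k} (t ∷ _ ∷ ts) = (t + 1ℤ) ∷ xsOf ts
ysOf {zero}  []           = []
ysOf {suc k} (_ ∷ u ∷ ts) = (u + 1ℤ) ∷ ysOf ts

chainMonomial≡monomial : (ts : Vec ℤ (k ℕ.* 2)) (σ : Vec Stat k) →
  chainMonomial (xsOf ts) (ysOf ts) σ ≡ monomial ts (flatten σ)
chainMonomial≡monomial {zero}  []           []             = refl
chainMonomial≡monomial {suc k} (t ∷ u ∷ ts) ((c , d) ∷ σ) = begin
  (t + 1ℤ - 1ℤ) ^ c * (u + 1ℤ - 1ℤ) ^ d * rest
    ≡⟨ cong₂ (λ t′ u′ → t′ ^ c * u′ ^ d * rest) (+1-1 t) (+1-1 u) ⟩
  t ^ c * u ^ d * rest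
    ≡⟨ ℤ.*-assoc (t ^ c) (u ^ d) rest ⟩
  t ^ c * (u ^ d * rest)
    ≡⟨ cong (λ z → t ^ c * (u ^ d * z)) (chainMonomial≡monomial ts σ) ⟩
  t ^ c * (u ^ d * monomial ts (flatten σ))
    ∎
  where
  rest : ℤ
  rest = chainMonomial (xsOf ts) (ysOf ts) σ
  +1-1 : ∀ t → t + 1ℤ - 1ℤ ≡ t
  +1-1 = solve-∀

exponents : Matroid n → ∀ k → List (Vec ℕ (k ℕ.* 2))
exponents M k = map (flatten ∘ stats M) (chainsAbove k ⊥)

exponents-bounded : (M : Matroid n) (k : ℕ) → Bounded n (exponents M k)
exponents-bounded {n} M k = map⁺ (ListAll.universal bounded _)
  where
  bounded : ∀ {k} (Ss : Vec (Subset n) k) → VecAll.All (_≤ n) (flatten (stats M Ss))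
  bounded []       = []
  bounded (S ∷ Ss) = ℕ.≤-trans (ℕ.m∸n≤m (rank M) (rk M S)) (rank≤n M)
                   ∷ ℕ.≤-trans (ℕ.m∸n≤m ∣ S ∣ (rk M S)) (∣p∣≤n S)
                   ∷ bounded Ss

∑-exponents : (M : Matroid n) (k : ℕ) (g : Vec ℕ (k ℕ.* 2) → ℤ) →
              ∑ (exponents M k) g ≡ statSum M k (g ∘ flatten)
∑-exponents M k g = ∑-map (flatten ∘ stats M) (chainsAbove k ⊥) g

≋-from-chainTutte : {M N : Matroid n} → (∀ xs ys → chainTutte M k xs ys ≡ chainTutte N k xs ys) →
                    M ≋[ k ] N
≋-from-chainTutte {n} {k} {M} {N} T≡T = sameStatSums λ h → begin
  statSum M k h                     ≡⟨ via-exponents M h ⟩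
  ∑ (exponents M k) (h ∘ unflatten) ≡⟨ monomialSums-determine-∑ n (exponents M k) (exponents N k)
                                         (exponents-bounded M k) (exponents-bounded N k)
                                         sameMonomialSums (h ∘ unflatten) ⟩
  ∑ (exponents N k) (h ∘ unflatten) ≡⟨ sym (via-exponents N h) ⟩
  statSum N k h                     ∎
  where
  via-exponents : ∀ K h → statSum K k h ≡ ∑ (exponents K k) (h ∘ unflatten)
  via-exponents K h = trans (chainSum-cong k ⊥ (λ Ss → cong h (sym (unflatten-flatten (stats K Ss)))))
                            (sym (∑-exponents K k (h ∘ unflatten)))
  monomialSum≡chainTutte : ∀ K ts → ∑ (exponents K k) (monomial ts) ≡
                           chainTutte K k (xsOf ts) (ysOf ts)
  monomialSum≡chainTutte K ts = begin
    ∑ (exponents K k) (monomial ts)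
      ≡⟨ ∑-exponents K k (monomial ts) ⟩
    statSum K k (monomial ts ∘ flatten)
      ≡⟨ chainSum-cong k ⊥ (λ Ss → sym (chainMonomial≡monomial ts (stats K Ss))) ⟩
    statSum K k (chainMonomial (xsOf ts) (ysOf ts))
      ≡⟨ sym (chainTutte≡statSum K k (xsOf ts) (ysOf ts)) ⟩
    chainTutte K k (xsOf ts) (ysOf ts)
      ∎
  sameMonomialSums : ∀ ts → ∑ (exponents M k) (monomial ts) ≡ ∑ (exponents N k) (monomial ts)
  sameMonomialSums ts = begin
    ∑ (exponents M k) (monomial ts)    ≡⟨ monomialSum≡chainTutte M ts ⟩
    chainTutte M k (xsOf ts) (ysOf ts) ≡⟨ T≡T (xsOf ts) (ysOf ts) ⟩
    chainTutte N k (xsOf ts) (ysOf ts) ≡⟨ sym (monomialSum≡chainTutte N ts) ⟩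
    ∑ (exponents N k) (monomial ts)    ∎

proposition3p3 : (n : ℕ) (M N : Matroid n)
    → (∀ (xs ys : Vec ℤ n) → chainTutte M n xs ys ≡ chainTutte N n xs ys)
    → (k : ℕ) → .{{_ : NonZero k}}
    → ∀ (xs ys : Vec ℤ k) → chainTutte M k xs ys ≡ chainTutte N k xs ys
proposition3p3 n M N Tⁿ≡Tⁿ (suc k) xs ys = begin
  chainTutte M (suc k) xs ys              ≡⟨ chainTutte≡statSum M (suc k) xs ys ⟩
  statSum M (suc k) (chainMonomial xs ys) ≡⟨ statSum-≡ (≋-everywhere (≋-from-chainTutte Tⁿ≡Tⁿ) k)
                                                       (chainMonomial xs ys) ⟩
  statSum N (suc k) (chainMonomial xs ys) ≡⟨ sym (chainTutte≡statSum N (suc k) xs ys) ⟩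
  chainTutte N (suc k) xs ys              ∎
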